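{- Let $\Lambda$ be a separating collection of $A$-predicate liftings for $\mathsf F$ and let $\mathsf{test}$ be an $A$-test for $\mathsf F$. If $\mathsf{test}$ is reducible (with respect to every $\lambda\in\Lambda$), then it is safe.
   Context: $\mathbf{A}=\langle A,\wedge,\vee,\odot,\to,0,1\rangle$ is an $\mathsf{FL}_{ew}$-algebra ($\langle A,\wedge,\vee,0,1\rangle$ bounded lattice, $\langle A,\odot,1\rangle$ commutative monoid, $x\odot y\le z\iff x\le y\to z$), possibly with further operations; $A^X$ is the set of maps $X\to A$; $t^{\mathrm{pw}}$ is the pointwise version of a term function $t$. $\mathsf F$ is a $\mathbf{Set}$-endofunctor; an $\mathsf F$-coalgebra is a map $\gamma:X\to\mathsf FX$, and $f:X\to Y$ is a coalgebra morphism $\gamma\to\gamma'$ if $\mathsf Ff\circ\gamma=\gamma'\circ f$. A $k$-ary $A$-predicate lifting is a family $\lambda_X:(A^X)^k\to A^{\mathsf FX}$ with $\lambda_X(\sigma_1\circ f,\dots,\sigma_k\circ f)=\lambda_Y(\sigma_1,\dots,\sigma_k)\circ\mathsf Ff$ for all $f:X\to Y$; transpose $\widehat\lambda_X(t)(\vec\sigma)=\lambda_X(\vec\sigma)(t)$. $\Lambda$ is separating if for every set $X$ and $t_1\ne t_2$ in $\mathsf FX$ there is $\lambda\in\Lambda$ with $\widehat\lambda_X(t_1)\ne\widehat\lambda_X(t_2)$. An $A$-test for $\mathsf F$ assigns to each set $X$ and $\sigma\in A^X$ an $\mathsf F$-coalgebra $\mathsf{test}(\sigma):X\to\mathsf FX$.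 It is safe if for all sets $X,Y$, $\sigma\in A^X$, $\sigma'\in A^Y$ and maps $f:X\to Y$ with $\sigma'\circ f=\sigma$, $f$ is a coalgebra morphism $\mathsf{test}(\sigma)\to\mathsf{test}(\sigma')$. It is reducible w.r.t. a $k$-ary $\lambda$ if there is a $(k+1)$-ary term function $t$ of $\mathbf A$ with $\lambda_X(\sigma_1,\dots,\sigma_k)\circ\mathsf{test}(\sigma)=t^{\mathrm{pw}}(\sigma,\sigma_1,\dots,\sigma_k)$ for all $X$ and $\sigma,\sigma_i\in A^X$; reducible if reducible w.r.t. every $\lambda\in\Lambda$. -}

module Defs where

open import Data.Nat using (ℕ; suc)
open import Data.Fin using (Fin)
open import Data.Product using (Σ; _×_)
open import Data.Vec.Functional using (_∷_)
open import Relation.Binary.PropositionalEquality using (_≡_)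
open import Function using (_∘_; id)

record FLew : Set₁ where
  infixr 6 _⊓_ _⊔_
  infixr 7 _⊙_
  infixr 5 _⇒_
  field
    Carrier : Set
    _⊓_ _⊔_ _⊙_ _⇒_ : Carrier → Carrier → Carrier
    𝟘 𝟙 : Carrier
    Op    : Set
    arity : Op → ℕ
    op    : (o : Op) → (Fin (arity o) → Carrier) → Carrier
    ⊓-assoc : ∀ x y z → (x ⊓ y) ⊓ z ≡ x ⊓ (y ⊓ z)
    ⊔-assoc : ∀ x y z → (x ⊔ y) ⊔ z ≡ x ⊔ (y ⊔ z)
    ⊓-comm  : ∀ x y → x ⊓ y ≡ y ⊓ x
    ⊔-comm  : ∀ x y → x ⊔ y ≡ y ⊔ x
    ⊓-absorbs-⊔ : ∀ x y → x ⊓ (x ⊔ y) ≡ x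
    ⊔-absorbs-⊓ : ∀ x y → x ⊔ (x ⊓ y) ≡ x
    -- bounds (order: x ≤ y iff x ⊓ y ≡ x)
    𝟘-least    : ∀ x → 𝟘 ⊓ x ≡ 𝟘
    𝟙-greatest : ∀ x → x ⊓ 𝟙 ≡ x
    ⊙-assoc : ∀ x y z → (x ⊙ y) ⊙ z ≡ x ⊙ (y ⊙ z)
    ⊙-comm  : ∀ x y → x ⊙ y ≡ y ⊙ x
    ⊙-identityʳ : ∀ x → x ⊙ 𝟙 ≡ x
    residuation₁ : ∀ x y z → (x ⊙ y) ⊓ z ≡ x ⊙ y → x ⊓ (y ⇒ z) ≡ x
    residuation₂ : ∀ x y z → x ⊓ (y ⇒ z) ≡ x → (x ⊙ y) ⊓ z ≡ x ⊙ y

module _ (𝔸 : FLew) where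
  open FLew 𝔸

  data Term (n : ℕ) : Set where
    var : Fin n → Term n
    bot top : Term n
    meet join mult impl : Term n → Term n → Term n
    app : (o : Op) → (Fin (arity o) → Term n) → Term n

  ⟦_⟧ : ∀ {n} → Term n → (Fin n → Carrier) → Carrier
  ⟦ var i ⟧ ρ = ρ i
  ⟦ bot ⟧ ρ = 𝟘
  ⟦ top ⟧ ρ = 𝟙
  ⟦ meet s t ⟧ ρ = ⟦ s ⟧ ρ ⊓ ⟦ t ⟧ ρ
  ⟦ join s t ⟧ ρ = ⟦ s ⟧ ρ ⊔ ⟦ t ⟧ ρ
  ⟦ mult s t ⟧ ρ = ⟦ s ⟧ ρ ⊙ ⟦ t ⟧ ρ
  ⟦ impl s t ⟧ ρ = ⟦ s ⟧ ρ ⇒ ⟦ t ⟧ ρ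
  ⟦ app o ts ⟧ ρ = op o (λ i → ⟦ ts i ⟧ ρ)

record Endofunctor : Set₁ where
  field
    F₀   : Set → Set
    fmap : ∀ {X Y : Set} → (X → Y) → F₀ X → F₀ Y
    fmap-id : ∀ {X : Set} (t : F₀ X) → fmap id t ≡ t
    fmap-∘  : ∀ {X Y Z : Set} (f : X → Y) (g : Y → Z) (t : F₀ X) →
              fmap (g ∘ f) t ≡ fmap g (fmap f t)

module _ (𝔽 : Endofunctor) where
  open Endofunctor 𝔽

  Coalg : Set → Set
  Coalg X = X → F₀ X

  IsCoalgMorphism : ∀ {X Y : Set} → Coalg X → Coalg Y → (X → Y) → Set
  IsCoalgMorphism γ γ' f = ∀ x → fmap f (γ x) ≡ γ' (f x)

module _ (𝔸 : FLew) (𝔽 : Endofunctor) where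
  open FLew 𝔸
  open Endofunctor 𝔽

  record PredLifting (k : ℕ) : Set₁ where
    field
      lift : (X : Set) → (Fin k → (X → Carrier)) → F₀ X → Carrier
      natural : ∀ {X Y : Set} (f : X → Y) (σs : Fin k → (Y → Carrier)) (t : F₀ X) →
                lift X (λ i → σs i ∘ f) t ≡ lift Y σs (fmap f t)

  record Liftings : Set₁ where
    field
      I   : Set
      ar  : I → ℕ
      lam : (i : I) → PredLifting (ar i)

  -- separating: liftings jointly distinguish elements of F X
  -- (contrapositive, pointwise form of: t₁ ≢ t₂ ⇒ ∃ λ. λ̂(t₁) ≢ λ̂(t₂))
  Separating : Liftings → Set₁
  Separating Λ = ∀ (X : Set) (t₁ t₂ : F₀ X) →
    (∀ (i : I) (σs : Fin (ar i) → (X → Carrier)) →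
       PredLifting.lift (lam i) X σs t₁ ≡ PredLifting.lift (lam i) X σs t₂) →
    t₁ ≡ t₂
    where open Liftings Λ

  Test : Set₁
  Test = (X : Set) → (X → Carrier) → Coalg 𝔽 X

  Safe : Test → Set₁
  Safe test = ∀ (X Y : Set) (σ : X → Carrier) (σ' : Y → Carrier) (f : X → Y) →
    (∀ x → σ' (f x) ≡ σ x) →
    IsCoalgMorphism 𝔽 (test X σ) (test Y σ') f

  ReducibleWrt : Test → ∀ {k} → PredLifting k → Set₁
  ReducibleWrt test {k} l = Σ (Term 𝔸 (suc k)) λ t →
    ∀ (X : Set) (σ : X → Carrier) (σs : Fin k → (X → Carrier)) (x : X) →
      PredLifting.lift l X σs (test X σ x) ≡ ⟦_⟧ 𝔸 t (σ x ∷ (λ i → σs i x))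

  Reducible : Liftings → Test → Set₁
  Reducible Λ test = ∀ (i : Liftings.I Λ) → ReducibleWrt test (Liftings.lam Λ i)

module Submission where

open import Defs
open import Data.Nat using (ℕ)
open import Data.Fin using (Fin)
open import Data.Product using (_,_)
open import Data.Vec.Functional using (_∷_)
open import Function using (_∘_)
open import Relation.Binary.PropositionalEquality using (_≡_; sym; cong; module ≡-Reasoning)

-- Naturality moves f from the state to the predicates, and reducibility evaluates a lifting
-- at a test state through the labels alone; since σ' ∘ f = σ, both sides of the coalgebra
-- morphism square look alike to every lifting, and separation identifies them.

module _ {𝔸 : FLew} {𝔽 : Endofunctor} where
  open FLew 𝔸 using (Carrier)
  open Endofunctor 𝔽 using (fmap)

  lift-fmap-test≡lift-test : (test : Test 𝔸 𝔽) {k : ℕ} (l : PredLifting 𝔸 𝔽 k) →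
    ReducibleWrt 𝔸 𝔽 test l →
    ∀ {X Y : Set} (σ : X → Carrier) (σ' : Y → Carrier) (f : X → Y) →
    (∀ x → σ' (f x) ≡ σ x) →
    ∀ (x : X) (σs : Fin k → (Y → Carrier)) →
    PredLifting.lift l Y σs (fmap f (test X σ x)) ≡ PredLifting.lift l Y σs (test Y σ' (f x))
  lift-fmap-test≡lift-test test l (t , reduce) {X} {Y} σ σ' f σ'∘f≡σ x σs = begin
    lift Y σs (fmap f (test X σ x))          ≡⟨ sym (natural f σs (test X σ x)) ⟩
    lift X (λ i → σs i ∘ f) (test X σ x)     ≡⟨ reduce X σ (λ i → σs i ∘ f) x ⟩
    ⟦_⟧ 𝔸 t (σ x ∷ (λ i → σs i (f x)))       ≡⟨ cong (λ a → ⟦_⟧ 𝔸 t (a ∷ _)) (sym (σ'∘f≡σ x)) ⟩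
    ⟦_⟧ 𝔸 t (σ' (f x) ∷ (λ i → σs i (f x)))  ≡⟨ sym (reduce Y σ' σs (f x)) ⟩
    lift Y σs (test Y σ' (f x))              ∎
    where
    open ≡-Reasoning
    open PredLifting l

proposition4p13 : (𝔸 : FLew) (𝔽 : Endofunctor) (Λ : Liftings 𝔸 𝔽) →
    Separating 𝔸 𝔽 Λ → (test : Test 𝔸 𝔽) →
    Reducible 𝔸 𝔽 Λ test → Safe 𝔸 𝔽 test
proposition4p13 𝔸 𝔽 Λ separating test reducible X Y σ σ' f σ'∘f≡σ x =
  separating Y _ _ λ i → lift-fmap-test≡lift-test test (Liftings.lam Λ i) (reducible i) σ σ' f σ'∘f≡σ x
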